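{- Let $\mathfrak{P}=\{\tilde{\mathcal{P}}_i:i\in\mathbb{N}\}$, where for $k>0$, $\mathcal{P}_k$ is the partial order on $\{0,\dots,2k+1\}$ generated (as reflexive–transitive closure) by $2i\le 2i+2$ for $i<k$ and $2i\le 2i+1$ for $i\le k$; and $\mathcal{P}_0$ is the partial order on $\mathbb{N}$ generated by $2i\le 2i+2$ for all $i$ and $2j\le 2j-1$ for all $j>0$. Then $\mathfrak{P}$ is both $E_0$-learnable and $E_{range}$-learnable, but it is not $\mathbf{nUs}$-learnable.
   Context: For a partial order $L$, $\tilde{L}$ is the partial order consisting of $L$ together with infinitely many new elements that are pairwise incomparable and incomparable with all elements of $L$ (so $\tilde L$ is countably infinite and may be taken with domain $\mathbb{N}$). All structures are countable with domain $\mathbb{N}$, finite relational signature, identified with atomic diagrams in $2^{\mathbb{N}}$ (subspace topology); $\mathcal{S}\restriction_s$ is the finite substructure on $\{0,\dots,s\}$. A family $\mathfrak{K}$ is a countable set of pairwise nonisomorphic countable structures; $\mathrm{LD}(\mathfrak{K})$ = structures isomorphic to a member of $\mathfrak{K}$; $\mathrm{HS}(\mathfrak{K})=\{\ulcorner\mathcal{A}\urcorner:\mathcal{A}\in\mathfrak{K}\}\cup\{?\}$. A learner is an arbitrary function from $\{\mathcal{S}\restriction_s:\mathcal{S}\in\mathrm{LD}(\mathfrak{K})\}$ to $\mathrm{HS}(\mathfrak{K})$. $\mathbf{M}$ $\mathbf{Ex}$-learns $\mathfrak{K}$ if $\lim_n\mathbf{M}(\mathcal{S}\restriction_n)=\ulcorner\mathcal{A}\urcorner$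 iff $\mathcal{S}\cong\mathcal{A}$, for all $\mathcal{S}\in\mathrm{LD}(\mathfrak{K})$, $\mathcal{A}\in\mathfrak{K}$. $\mathbf{M}$ $\mathbf{nUs}$-learns $\mathfrak{K}$ if it $\mathbf{Ex}$-learns $\mathfrak{K}$ and, whenever $\mathcal{S}\cong\mathcal{A}$, after the first stage at which $\mathbf{M}$ outputs $\ulcorner\mathcal{A}\urcorner$ it outputs $\ulcorner\mathcal{A}\urcorner$ forever. For an equivalence relation $E$ on $X$, $\mathfrak{K}$ is $E$-learnable if there is a continuous $\Gamma:\mathrm{LD}(\mathfrak{K})\to X$ with $\mathcal{S}\cong\mathcal{S}'\iff\Gamma(\mathcal{S})\,E\,\Gamma(\mathcal{S}')$ for all $\mathcal{S},\mathcal{S}'\in\mathrm{LD}(\mathfrak{K})$. On $\mathbb{N}^{\mathbb{N}}$: $p\,E_0\,q$ iff $\exists m\,\forall n\ge m\ p(n)=q(n)$; $p\,E_{range}\,q$ iff $\{p(m)\}_m=\{q(m)\}_m$. -}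

module Defs where

open import Data.Nat using (ℕ; zero; suc; _+_; _*_; _∸_; _≤_; _<_)
open import Data.Bool using (Bool; true)
open import Data.Maybe using (Maybe; just)
open import Data.Product using (Σ; ∃; _×_)
open import Data.Sum using (_⊎_; inj₁; inj₂)
open import Data.Empty using (⊥)
open import Relation.Nullary using (¬_)
open import Relation.Binary.PropositionalEquality using (_≡_)
open import Relation.Binary.Construct.Closure.ReflexiveTransitive using (Star)
open import Function.Bundles using (_↔_; _⇔_; Inverse)

-- Countable structures in the signature of partial orders {≤}:
-- domain ℕ, atomic diagram given by a Boolean-valued relation.

Str : Set
Str = ℕ → ℕ → Bool

Agree : ℕ → Str → Str → Set
Agree s S S' = ∀ x y → x ≤ s → y ≤ s → S x y ≡ S' x y

StrIso : Str → Str → Set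
StrIso S S' = Σ (ℕ ↔ ℕ) λ f → ∀ x y → S x y ≡ S' (Inverse.to f x) (Inverse.to f y)

data Gen0 : ℕ → ℕ → Set where
  chain0 : ∀ i → Gen0 (2 * i) (2 * i + 2)
  up0    : ∀ j → 0 < j → Gen0 (2 * j) (2 * j ∸ 1)

data GenK (k : ℕ) : ℕ → ℕ → Set where
  chainK : ∀ i → i < k → GenK k (2 * i) (2 * i + 2)
  upK    : ∀ i → i ≤ k → GenK k (2 * i) (2 * i + 1)

PCar : ℕ → Set
PCar zero    = ℕ
PCar (suc k) = Σ ℕ λ x → x ≤ 2 * suc k + 1

POrd : (k : ℕ) → PCar k → PCar k → Set
POrd zero    x y = Star Gen0 x y
POrd (suc k) x y = Star (GenK (suc k)) (Data.Product.proj₁ x) (Data.Product.proj₁ y)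

-- P̃_k : P_k together with infinitely many (ℕ-indexed) new elements,
-- pairwise incomparable and incomparable with P_k
PTCar : ℕ → Set
PTCar k = PCar k ⊎ ℕ

PTOrd : (k : ℕ) → PTCar k → PTCar k → Set
PTOrd k (inj₁ a) (inj₁ b) = POrd k a b
PTOrd k (inj₂ m) (inj₂ n) = m ≡ n
PTOrd k (inj₁ _) (inj₂ _) = ⊥
PTOrd k (inj₂ _) (inj₁ _) = ⊥

IsoP : Str → ℕ → Set
IsoP S k = Σ (ℕ ↔ PTCar k) λ f →
  ∀ x y → (S x y ≡ true) ⇔ PTOrd k (Inverse.to f x) (Inverse.to f y)

LD : Str → Set
LD S = Σ ℕ λ k → IsoP S k

-- Hypothesis space HS(𝔓) = Maybe ℕ (just k = ⌜P̃_k⌝, nothing = ?).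
-- A learner is a function on {S↾s : S ∈ LD(𝔓)}; we present it as a
-- function of (S, membership proof, s) that depends only on S↾s.

record Learner : Set where
  field
    M        : (S : Str) → LD S → ℕ → Maybe ℕ
    coherent : ∀ S S' (p : LD S) (p' : LD S') s → Agree s S S' → M S p s ≡ M S' p' s

Converges : (ℕ → Maybe ℕ) → ℕ → Set
Converges f a = ∃ λ m → ∀ n → m ≤ n → f n ≡ just a

ExLearns : Learner → Set
ExLearns L = ∀ S (p : LD S) k → Converges (Learner.M L S p) k ⇔ IsoP S k

NUsLearns : Learner → Set
NUsLearns L = ExLearns L ×
  (∀ S (p : LD S) k → IsoP S k → ∀ n → Learner.M L S p n ≡ just k →
     ∀ m → n ≤ m → Learner.M L S p m ≡ just k)

NUsLearnable : Set
NUsLearnable = Σ Learner NUsLearns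

Baire : Set
Baire = ℕ → ℕ

-- Γ : LD(𝔓) → ℕ^ℕ continuous (w.r.t. subspace topology of 2^ℕ)
-- and reducing ≅ to E
ELearnable : (Baire → Baire → Set) → Set
ELearnable E = Σ ((S : Str) → LD S → Baire) λ Γ →
  (∀ S (p : LD S) n → ∃ λ m → ∀ S' (p' : LD S') → Agree m S S' → Γ S' p' n ≡ Γ S p n)
  × (∀ S (p : LD S) S' (p' : LD S') → StrIso S S' ⇔ E (Γ S p) (Γ S' p'))

E0 : Baire → Baire → Set
E0 p q = ∃ λ m → ∀ n → m ≤ n → p n ≡ q n

Erange : Baire → Baire → Set
Erange p q = (∀ m → ∃ λ n → p m ≡ q n) × (∀ m → ∃ λ n → q m ≡ p n)

-- In P_0 the element 2 is the least element strictly above 0 and is not maximal. No P_k with k > 0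
-- has such a pair: above 2i lie both 2i+1 and 2i+2, which are incomparable, and 2k+1 is maximal.
-- Chains in P_k have at most k+2 elements, while P_0 has arbitrarily long ones. Hence the reduction
-- for E_0 outputs 0 once that pattern is visible and otherwise the length of the longest visible chain
-- minus one; it converges to the index k. The reduction for E_range enumerates the lengths of visible
-- chains, whose range {0,…,k+1} for k > 0, or ℕ for k = 0, determines k.
-- A learner that settles on P̃_0 for a presentation A by stage N cannot be nUs: a presentation B of
-- P̃_(N+1) agrees with A up to N, and the learner settles on B by some stage N′; a presentation C of
-- P̃_0 agrees with B up to N ⊔ N′, so on C it guesses P̃_0 at stage N and later P̃_(N+1).

module Submission where

open import Defs
open import Data.Bool using (Bool; true; false; if_then_else_)
open import Data.Empty using (⊥; ⊥-elim)
open import Data.Unit using (⊤; tt)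
open import Data.Nat
open import Data.Nat.Properties
open import Data.Maybe using (just)
open import Data.Maybe.Properties using (just-injective)
open import Data.Product using (Σ; ∃; _×_; _,_; proj₁; proj₂)
open import Data.Sum using (_⊎_; inj₁; inj₂; [_,_]′)
import Data.Sum as Sum
open import Data.Sum.Properties using (inj₁-injective; inj₂-injective)
open import Function.Base using (id; _∘_)
open import Function.Definitions using (Injective)
open import Function.Bundles using (_↔_; _⇔_; Inverse; Equivalence; mk⇔; mk↔ₛ′)
open import Function.Construct.Composition using (_⇔-∘_)
open import Function.Construct.Symmetry using (⇔-sym)
open import Relation.Binary.PropositionalEquality
open import Relation.Binary.Construct.Closure.ReflexiveTransitive using (Star; ε; _◅_; _◅◅_; fold)
open import Relation.Nullary using (¬_; Dec; yes; no; does; contradiction)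
open import Relation.Nullary.Decidable using (map′; ¬?; _×-dec_; _⊎-dec_; _→-dec_; does-⇔; dec-true; dec-false)

open Inverse using (to; from; strictlyInverseˡ; strictlyInverseʳ)

split : ℕ → ℕ ⊎ ℕ
split zero          = inj₁ zero
split (suc zero)    = inj₂ zero
split (suc (suc n)) = Sum.map suc suc (split n)

merge : ℕ ⊎ ℕ → ℕ
merge (inj₁ i) = 2 * i
merge (inj₂ i) = suc (2 * i)

merge-split : ∀ n → merge (split n) ≡ n
merge-split zero          = refl
merge-split (suc zero)    = refl
merge-split (suc (suc n)) with split n | merge-split n
... | inj₁ i | refl = *-suc 2 i
... | inj₂ i | refl = cong suc (*-suc 2 i)

split-even : ∀ i → split (2 * i) ≡ inj₁ i
split-even zero    = refl
split-even (suc i) = trans (cong split (*-suc 2 i)) (cong (Sum.map suc suc) (split-even i))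

split-odd : ∀ i → split (suc (2 * i)) ≡ inj₂ i
split-odd zero    = refl
split-odd (suc i) = trans (cong (split ∘ suc) (*-suc 2 i)) (cong (Sum.map suc suc) (split-odd i))

split-merge : ∀ a → split (merge a) ≡ a
split-merge (inj₁ i) = split-even i
split-merge (inj₂ i) = split-odd i

ℕ↔ℕ⊎ℕ : ℕ ↔ (ℕ ⊎ ℕ)
ℕ↔ℕ⊎ℕ = mk↔ₛ′ split merge split-merge merge-split

interleave : {A : Set} → (ℕ → A) → (ℕ → A) → ℕ → A
interleave e o = [ e , o ]′ ∘ split

interleave-even : ∀ {A : Set} {e o : ℕ → A} i → interleave e o (2 * i) ≡ e i
interleave-even {e = e} {o} i = cong [ e , o ]′ (split-even i)

interleave-odd : ∀ {A : Set} {e o : ℕ → A} i → interleave e o (suc (2 * i)) ≡ o i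
interleave-odd {e = e} {o} i = cong [ e , o ]′ (split-odd i)

data EvenOdd : ℕ → Set where
  even : ∀ i → EvenOdd (2 * i)
  odd  : ∀ i → EvenOdd (suc (2 * i))

evenOdd : ∀ n → EvenOdd n
evenOdd n = subst EvenOdd (merge-split n) (view (split n))
  where
  view : ∀ a → EvenOdd (merge a)
  view (inj₁ i) = even i
  view (inj₂ i) = odd i

*2-injective : ∀ {i j} → 2 * i ≡ 2 * j → i ≡ j
*2-injective {i} {j} = *-cancelˡ-≡ i j 2

⌊2*n/2⌋≡n : ∀ n → ⌊ 2 * n /2⌋ ≡ n
⌊2*n/2⌋≡n zero = refl
⌊2*n/2⌋≡n (suc n) = trans (cong ⌊_/2⌋ (*-suc 2 n)) (cong suc (⌊2*n/2⌋≡n n))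

⌊1+2*n/2⌋≡n : ∀ n → ⌊ suc (2 * n) /2⌋ ≡ n
⌊1+2*n/2⌋≡n zero = refl
⌊1+2*n/2⌋≡n (suc n) = trans (cong (⌊_/2⌋ ∘ suc) (*-suc 2 n)) (cong suc (⌊1+2*n/2⌋≡n n))

⌊n/2⌋≤-bound : ∀ {n K} → n ≤ 2 * K + 1 → ⌊ n /2⌋ ≤ K
⌊n/2⌋≤-bound {n} {K} n≤ = begin
  ⌊ n /2⌋             ≤⟨ ⌊n/2⌋-mono n≤ ⟩
  ⌊ 2 * K + 1 /2⌋     ≡⟨ cong ⌊_/2⌋ (+-comm (2 * K) 1) ⟩
  ⌊ suc (2 * K) /2⌋   ≡⟨ ⌊1+2*n/2⌋≡n K ⟩
  K                   ∎
  where open ≤-Reasoning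

⌈n/2⌉≤-bound : ∀ {n K} → n ≤ 2 * K + 1 → ⌈ n /2⌉ ≤ suc K
⌈n/2⌉≤-bound {n} {K} n≤ =
  ≤-trans (⌈n/2⌉-mono n≤) (≤-reflexive (trans (cong ⌈_/2⌉ (+-comm (2 * K) 1)) (cong suc (⌊2*n/2⌋≡n K))))

-- The order of P_0 is ⊑[ ⌈_/2⌉ ], that of P_k for k > 0 is ⊑[ ⌊_/2⌋ ] (POrd₀⇔, POrdₛ⇔).

_⊑[_]_ : ℕ → (ℕ → ℕ) → ℕ → Set
x ⊑[ g ] y = x ≡ y ⊎ ∃ λ i → x ≡ 2 * i × i ≤ g y

⊑-trans : ∀ {g} → (∀ i → g (2 * i) ≡ i) → ∀ {x y z} → x ⊑[ g ] y → y ⊑[ g ] z → x ⊑[ g ] z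
⊑-trans g2 (inj₁ refl) q = q
⊑-trans g2 p (inj₁ refl) = p
⊑-trans g2 (inj₂ (i , refl , i≤)) (inj₂ (j , refl , j≤)) =
  inj₂ (i , refl , ≤-trans (subst (i ≤_) (g2 j) i≤) j≤)

⊑-dec : ∀ g x y → Dec (x ⊑[ g ] y)
⊑-dec g x y = x ≟ y ⊎-dec below (evenOdd x)
  where
  below : ∀ {x} → EvenOdd x → Dec (∃ λ i → x ≡ 2 * i × i ≤ g y)
  below (even i) = map′ (λ i≤ → i , refl , i≤)
                        (λ { (j , e , j≤) → subst (_≤ g y) (sym (*2-injective e)) j≤ })
                        (i ≤? g y)
  below (odd i)  = no λ { (j , e , _) → even≢odd j i (sym e) }

⊑-strict : ∀ {x y} → x ⊑[ ⌊_/2⌋ ] y → x ≢ y → ∃ λ i → x ≡ 2 * i × i < ⌈ y /2⌉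
⊑-strict (inj₁ x≡y) x≢y = contradiction x≡y x≢y
⊑-strict {y = y} (inj₂ (i , refl , i≤)) x≢y = i , refl , climb (evenOdd y) i≤ x≢y
  where
  climb : ∀ {y} → EvenOdd y → i ≤ ⌊ y /2⌋ → 2 * i ≢ y → i < ⌈ y /2⌉
  climb (even j) i≤ ne rewrite ⌊1+2*n/2⌋≡n j | ⌊2*n/2⌋≡n j = ≤∧≢⇒< i≤ (ne ∘ cong (2 *_))
  climb (odd j)  i≤ _  rewrite ⌊1+2*n/2⌋≡n j | ⌊2*n/2⌋≡n j = s≤s i≤

2*n+2≡2*[1+n] : ∀ n → 2 * n + 2 ≡ 2 * suc n
2*n+2≡2*[1+n] n = trans (+-comm (2 * n) 2) (sym (*-suc 2 n))

chain0′ : ∀ l → Gen0 (2 * l) (2 * suc l)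
chain0′ l = subst (Gen0 (2 * l)) (2*n+2≡2*[1+n] l) (chain0 l)

up0′ : ∀ j → Gen0 (2 * suc j) (suc (2 * j))
up0′ j = subst (Gen0 (2 * suc j)) (cong (_∸ 1) (*-suc 2 j)) (up0 (suc j) z<s)

chainK′ : ∀ {K} l → l < K → GenK K (2 * l) (2 * suc l)
chainK′ {K} l l<K = subst (GenK K (2 * l)) (2*n+2≡2*[1+n] l) (chainK l l<K)

upK′ : ∀ {K} j → j ≤ K → GenK K (2 * j) (suc (2 * j))
upK′ {K} j j≤K = subst (GenK K (2 * j)) (+-comm (2 * j) 1) (upK j j≤K)

evens-path : ∀ {G : ℕ → ℕ → Set} {i j} →
             (∀ l → l < j → G (2 * l) (2 * suc l)) → i ≤ j → Star G (2 * i) (2 * j)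
evens-path {j = zero}  step z≤n = ε
evens-path {j = suc j} step i≤ with m≤n⇒m<n∨m≡n i≤
... | inj₂ refl  = ε
... | inj₁ i<1+j =
  evens-path (λ l l<j → step l (m<n⇒m<1+n l<j)) (m<1+n⇒m≤n i<1+j) ◅◅ (step j ≤-refl ◅ ε)

P₀-sound : ∀ {x y} → Star Gen0 x y → x ⊑[ ⌈_/2⌉ ] y
P₀-sound = fold _ (λ g p → ⊑-trans ⌊1+2*n/2⌋≡n (generator g) p) (inj₁ refl)
  where
  generator : ∀ {x y} → Gen0 x y → x ⊑[ ⌈_/2⌉ ] y
  generator (chain0 i)       = inj₂ (i , refl ,
    subst (λ y → i ≤ ⌈ y /2⌉) (sym (2*n+2≡2*[1+n] i))
          (subst (i ≤_) (sym (⌊1+2*n/2⌋≡n (suc i))) (n≤1+n i)))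
  generator (up0 (suc j) _) = inj₂ (suc j , refl ,
    ≤-reflexive (sym (trans (cong ⌈_/2⌉ (cong (_∸ 1) (*-suc 2 j))) (cong suc (⌊2*n/2⌋≡n j)))))

P₀-complete : ∀ {x y} → x ⊑[ ⌈_/2⌉ ] y → Star Gen0 x y
P₀-complete (inj₁ refl) = ε
P₀-complete {y = y} (inj₂ (i , refl , i≤)) = path (evenOdd y) i≤
  where
  path : ∀ {y} → EvenOdd y → i ≤ ⌈ y /2⌉ → Star Gen0 (2 * i) y
  path (even j) i≤ = evens-path (λ l _ → chain0′ l) (subst (i ≤_) (⌊1+2*n/2⌋≡n j) i≤)
  path (odd j)  i≤ = evens-path (λ l _ → chain0′ l) (subst (i ≤_) (cong suc (⌊2*n/2⌋≡n j)) i≤)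
                     ◅◅ (up0′ j ◅ ε)

Pₖ-sound : ∀ {K x y} → Star (GenK K) x y → x ⊑[ ⌊_/2⌋ ] y
Pₖ-sound = fold _ (λ g p → ⊑-trans ⌊2*n/2⌋≡n (generator g) p) (inj₁ refl)
  where
  generator : ∀ {K x y} → GenK K x y → x ⊑[ ⌊_/2⌋ ] y
  generator (chainK i _) = inj₂ (i , refl ,
    subst (λ y → i ≤ ⌊ y /2⌋) (sym (2*n+2≡2*[1+n] i))
          (subst (i ≤_) (sym (⌊2*n/2⌋≡n (suc i))) (n≤1+n i)))
  generator (upK i _)    = inj₂ (i , refl ,
    subst (λ y → i ≤ ⌊ y /2⌋) (+-comm 1 (2 * i)) (≤-reflexive (sym (⌊1+2*n/2⌋≡n i))))

Pₖ-complete : ∀ {K x y} → y ≤ 2 * K + 1 → x ⊑[ ⌊_/2⌋ ] y → Star (GenK K) x y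
Pₖ-complete _ (inj₁ refl) = ε
Pₖ-complete {K} {y = y} y≤ (inj₂ (i , refl , i≤)) = path (evenOdd y) y≤ i≤
  where
  path : ∀ {y} → EvenOdd y → y ≤ 2 * K + 1 → i ≤ ⌊ y /2⌋ → Star (GenK K) (2 * i) y
  path (even j) y≤ i≤ =
    evens-path (λ l l<j → chainK′ l (<-≤-trans l<j j≤K)) (subst (i ≤_) (⌊2*n/2⌋≡n j) i≤)
    where j≤K = subst (_≤ K) (⌊2*n/2⌋≡n j) (⌊n/2⌋≤-bound y≤)
  path (odd j) y≤ i≤ =
    evens-path (λ l l<j → chainK′ l (<-≤-trans l<j j≤K)) (subst (i ≤_) (⌊1+2*n/2⌋≡n j) i≤)
    ◅◅ (upK′ j j≤K ◅ ε)
    where j≤K = subst (_≤ K) (⌊1+2*n/2⌋≡n j) (⌊n/2⌋≤-bound y≤)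

POrd₀⇔ : ∀ {x y} → POrd 0 x y ⇔ x ⊑[ ⌈_/2⌉ ] y
POrd₀⇔ = mk⇔ P₀-sound P₀-complete

POrdₛ⇔ : ∀ {K} (α β : PCar (suc K)) → POrd (suc K) α β ⇔ proj₁ α ⊑[ ⌊_/2⌋ ] proj₁ β
POrdₛ⇔ _ (_ , b≤) = mk⇔ Pₖ-sound (Pₖ-complete b≤)

label-≡ : ∀ {K} {α β : PCar (suc K)} → proj₁ α ≡ proj₁ β → α ≡ β
label-≡ {α = a , p} {β = .a , q} refl = cong (a ,_) (≤-irrelevant p q)

POrd? : ∀ k α β → Dec (POrd k α β)
POrd? zero    x y = map′ P₀-complete P₀-sound (⊑-dec ⌈_/2⌉ x y)
POrd? (suc K) α β = map′ (Equivalence.from (POrdₛ⇔ α β)) Pₖ-sound (⊑-dec ⌊_/2⌋ (proj₁ α) (proj₁ β))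

PTOrd? : ∀ k a b → Dec (PTOrd k a b)
PTOrd? k (inj₁ α) (inj₁ β) = POrd? k α β
PTOrd? k (inj₂ m) (inj₂ n) = m ≟ n
PTOrd? k (inj₁ _) (inj₂ _) = no λ ()
PTOrd? k (inj₂ _) (inj₁ _) = no λ ()

does≡true⇔ : ∀ {P : Set} (d : Dec P) → (does d ≡ true) ⇔ P
does≡true⇔ (yes p) = mk⇔ (λ _ → p) (λ _ → refl)
does≡true⇔ (no ¬p) = mk⇔ (λ ()) (λ p → contradiction p ¬p)

≡true-ext : ∀ {b c : Bool} → (b ≡ true) ⇔ (c ≡ true) → b ≡ c
≡true-ext {true}  {true}  _ = refl
≡true-ext {true}  {false} e = sym (Equivalence.to e refl)
≡true-ext {false} {true}  e = Equivalence.from e refl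
≡true-ext {false} {false} _ = refl

presentation : (k : ℕ) → ℕ ↔ PTCar k → Str
presentation k f x y = does (PTOrd? k (to f x) (to f y))

presentation-IsoP : ∀ k f → IsoP (presentation k f) k
presentation-IsoP k f = f , λ x y → does≡true⇔ (PTOrd? k (to f x) (to f y))

IsoP-respects-StrIso : ∀ {S S' k} → IsoP S k → StrIso S S' → IsoP S' k
IsoP-respects-StrIso {S} {S'} {k} (f , f-iso) (h , h-iso) = f′ , λ x y →
  mk⇔ (λ e → Equivalence.to (f-iso (from h x) (from h y)) (trans (sym (S'≡ x y)) e))
      (λ o → trans (S'≡ x y) (Equivalence.from (f-iso (from h x) (from h y)) o))
  where
  f′ : ℕ ↔ PTCar k
  f′ = mk↔ₛ′ (to f ∘ from h) (to h ∘ from f)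
         (λ a → trans (cong (to f) (strictlyInverseʳ h (from f a))) (strictlyInverseˡ f a))
         (λ x → trans (cong (to h) (strictlyInverseʳ f (from h x))) (strictlyInverseˡ h x))
  S'≡ : ∀ x y → S' x y ≡ S (from h x) (from h y)
  S'≡ x y = sym (trans (h-iso (from h x) (from h y))
                       (cong₂ S' (strictlyInverseˡ h x) (strictlyInverseˡ h y)))

IsoP⇒StrIso : ∀ {S S' k} → IsoP S k → IsoP S' k → StrIso S S'
IsoP⇒StrIso {S} {S'} {k} (f , f-iso) (g , g-iso) = h , λ x y → ≡true-ext (mk⇔
  (λ e → Equivalence.from (g-iso _ _) (subst₂ (PTOrd k) (sym (gf x)) (sym (gf y))
                                         (Equivalence.to (f-iso x y) e)))
  (λ e → Equivalence.from (f-iso x y) (subst₂ (PTOrd k) (gf x) (gf y)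
                                         (Equivalence.to (g-iso _ _) e))))
  where
  h : ℕ ↔ ℕ
  h = mk↔ₛ′ (from g ∘ to f) (from f ∘ to g)
        (λ x → trans (cong (from g) (strictlyInverseˡ f (to g x))) (strictlyInverseʳ g x))
        (λ x → trans (cong (from f) (strictlyInverseˡ g (to f x))) (strictlyInverseʳ f x))
  gf : ∀ x → to g (from g (to f x)) ≡ to f x
  gf x = strictlyInverseˡ g (to f x)

Strict : Str → ℕ → ℕ → Set
Strict S x y = x ≢ y × S x y ≡ true

strict? : ∀ S x y → Dec (Strict S x y)
strict? S x y = ¬? (x ≟ y) ×-dec (S x y Data.Bool.≟ true)

-- j strict steps ending in x; only the elements below x are required to be ≤ t
ChainTo : Str → ℕ → ℕ → ℕ → Set
ChainTo S t zero    x = ⊤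
ChainTo S t (suc j) x = ∃ λ y → y < suc t × (Strict S y x × ChainTo S t j y)

chainTo? : ∀ S t j x → Dec (ChainTo S t j x)
chainTo? S t zero    x = yes tt
chainTo? S t (suc j) x = anyUpTo? (λ y → strict? S y x ×-dec chainTo? S t j y) (suc t)

HasChain : Str → ℕ → ℕ → Set
HasChain S t j = ∃ λ x → x < suc t × ChainTo S t j x

hasChain? : ∀ S t j → Dec (HasChain S t j)
hasChain? S t j = anyUpTo? (chainTo? S t j) (suc t)

hasChain-downward : ∀ {S t j j′} → j ≤ j′ → HasChain S t j′ → HasChain S t j
hasChain-downward {j′ = zero}   z≤n has = has
hasChain-downward {j′ = suc j′} j≤ has@(_ , _ , y , y< , _ , ch) with m≤n⇒m<n∨m≡n j≤
... | inj₂ refl = has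
... | inj₁ j<   = hasChain-downward (m<1+n⇒m≤n j<) (y , y< , ch)

LeastAbove : Str → ℕ → ℕ → ℕ → Set
LeastAbove S t b c = Strict S b c × (∀ {z} → z < suc t → Strict S b z → z ≡ c ⊎ Strict S c z)

leastAbove? : ∀ S t b c → Dec (LeastAbove S t b c)
leastAbove? S t b c =
  strict? S b c ×-dec allUpTo? (λ z → strict? S b z →-dec (z ≟ c ⊎-dec strict? S c z)) (suc t)

P₀-Signal : Str → ℕ → Set
P₀-Signal S t = ∃ λ b → b < suc t × ∃ λ c → c < suc t × ∃ λ d → d < suc t ×
                (LeastAbove S t b c × Strict S c d)

P₀-signal? : ∀ S t → Dec (P₀-Signal S t)
P₀-signal? S t = anyUpTo? (λ b → anyUpTo? (λ c → anyUpTo? (λ d →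
                   leastAbove? S t b c ×-dec strict? S c d) (suc t)) (suc t)) (suc t)

Agree-sym : ∀ {t S S'} → Agree t S S' → Agree t S' S
Agree-sym agree x y x≤ y≤ = sym (agree x y x≤ y≤)

strict-agree : ∀ {t S S' x y} → Agree t S S' → x < suc t → y < suc t → Strict S x y → Strict S' x y
strict-agree agree x< y< (x≢y , Sxy) =
  x≢y , trans (sym (agree _ _ (m<1+n⇒m≤n x<) (m<1+n⇒m≤n y<))) Sxy

module Agreement {t S S'} (agree : Agree t S S') where

  chainTo-agree : ∀ j {x} → x < suc t → ChainTo S t j x → ChainTo S' t j x
  chainTo-agree zero    _  _                  = tt
  chainTo-agree (suc j) x< (y , y< , y≺x , ch) = y , y< , strict-agree agree y< x< y≺x , chainTo-agree j y< ch

  hasChain-agree : ∀ j → HasChain S t j → HasChain S' t j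
  hasChain-agree j (x , x< , ch) = x , x< , chainTo-agree j x< ch

  P₀-signal-agree : P₀-Signal S t → P₀-Signal S' t
  P₀-signal-agree (b , b< , c , c< , d , d< , (b≺c , least) , c≺d) =
    b , b< , c , c< , d , d< , (strict-agree agree b< c< b≺c , least′) , strict-agree agree c< d< c≺d
    where
    least′ : ∀ {z} → z < suc t → Strict S' b z → z ≡ c ⊎ Strict S' c z
    least′ z< b≺z with least z< (strict-agree (Agree-sym agree) b< z< b≺z)
    ... | inj₁ z≡c = inj₁ z≡c
    ... | inj₂ c≺z = inj₂ (strict-agree agree c< z< c≺z)

hasChain-≡ : ∀ {t S S'} → Agree t S S' → ∀ j → does (hasChain? S t j) ≡ does (hasChain? S' t j)
hasChain-≡ {t} {S} {S'} agree j = does-⇔ (mk⇔ (Agreement.hasChain-agree agree j)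
                                 (Agreement.hasChain-agree (Agree-sym agree) j))
                         (hasChain? S t j) (hasChain? S' t j)

P₀-signal-≡ : ∀ {t S S'} → Agree t S S' → does (P₀-signal? S t) ≡ does (P₀-signal? S' t)
P₀-signal-≡ {t} {S} {S'} agree = does-⇔ (mk⇔ (Agreement.P₀-signal-agree agree)
                                (Agreement.P₀-signal-agree (Agree-sym agree)))
                         (P₀-signal? S t) (P₀-signal? S' t)

≤-bounded : ∀ n (g : Σ ℕ (_≤ n) → ℕ) → ∃ λ N → ∀ α → g α ≤ N
≤-bounded zero    g = g (0 , z≤n) , λ { (0 , z≤n) → ≤-refl }
≤-bounded (suc n) g with ≤-bounded n (λ (x , x≤n) → g (x , m≤n⇒m≤1+n x≤n))
... | N , g≤N = g (suc n , ≤-refl) ⊔ N , bound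
  where
  bound : ∀ α → g α ≤ g (suc n , ≤-refl) ⊔ N
  bound (x , x≤) with m≤n⇒m<n∨m≡n x≤
  ... | inj₂ refl = ≤-trans (≤-reflexive (cong (λ p → g (suc n , p)) (≤-irrelevant x≤ ≤-refl)))
                            (m≤m⊔n _ N)
  ... | inj₁ x<   = ≤-trans (≤-reflexive (cong (λ p → g (x , p)) (≤-irrelevant _ _)))
                            (≤-trans (g≤N (x , m<1+n⇒m≤n x<)) (m≤n⊔m _ N))

module Presentation {S : Str} {k : ℕ} (iso : IsoP S k) where

  f : ℕ ↔ PTCar k
  f = proj₁ iso

  pos : PCar k → ℕ
  pos α = from f (inj₁ α)

  pos-injective : ∀ {α β} → pos α ≡ pos β → α ≡ β
  pos-injective e = inj₁-injective
    (trans (sym (strictlyInverseˡ f _)) (trans (cong (to f) e) (strictlyInverseˡ f _)))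

  strict-pos⇔ : ∀ {α β} → Strict S (pos α) (pos β) ⇔ (POrd k α β × α ≢ β)
  strict-pos⇔ {α} {β} = mk⇔
    (λ (pos≢ , S≡) → subst₂ (PTOrd k) (strictlyInverseˡ f _) (strictlyInverseˡ f _)
                                       (Equivalence.to (proj₂ iso _ _) S≡)
                   , pos≢ ∘ cong pos)
    (λ (o , α≢β) → (α≢β ∘ pos-injective)
                 , Equivalence.from (proj₂ iso _ _)
                     (subst₂ (PTOrd k) (sym (strictlyInverseˡ f _)) (sym (strictlyInverseˡ f _)) o))

  strict-inv : ∀ {x y} → Strict S x y → ∃ λ α → ∃ λ β → x ≡ pos α × y ≡ pos β
  strict-inv {x} {y} (x≢y , Sxy) = endpoints (to f x) (to f y) refl refl
    where
    back : ∀ {x a} → to f x ≡ a → x ≡ from f a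
    back {x} e = trans (sym (strictlyInverseʳ f x)) (cong (from f) e)
    order : ∀ {a b} → to f x ≡ a → to f y ≡ b → PTOrd k a b
    order fx fy = subst₂ (PTOrd k) fx fy (Equivalence.to (proj₂ iso x y) Sxy)
    endpoints : ∀ a b → to f x ≡ a → to f y ≡ b → ∃ λ α → ∃ λ β → x ≡ pos α × y ≡ pos β
    endpoints (inj₁ α) (inj₁ β) fx fy = α , β , back fx , back fy
    endpoints (inj₂ m) (inj₂ n) fx fy =
      contradiction (trans (back fx) (trans (cong (from f ∘ inj₂) (order fx fy)) (sym (back fy)))) x≢y
    endpoints (inj₁ _) (inj₂ _) fx fy = ⊥-elim (order fx fy)
    endpoints (inj₂ _) (inj₁ _) fx fy = ⊥-elim (order fx fy)

module Presentation₀ {S : Str} (iso : IsoP S 0) where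
  open Presentation iso

  evens-bound : ∀ j → ∃ λ N → ∀ i → i ≤ j → pos (2 * i) ≤ N
  evens-bound j with ≤-bounded j (λ (i , _) → pos (2 * i))
  ... | N , bound = N , λ i i≤j → bound (i , i≤j)

  evens-strict : ∀ i → Strict S (pos (2 * i)) (pos (2 * suc i))
  evens-strict i = Equivalence.from strict-pos⇔ (chain0′ i ◅ ε , 1+n≢n ∘ sym ∘ *2-injective)

  evens-chain : ∀ {t} j → (∀ i → i ≤ j → pos (2 * i) ≤ t) → ChainTo S t j (pos (2 * j))
  evens-chain zero    _     = tt
  evens-chain (suc j) below = pos (2 * j) , s≤s (below j (n≤1+n j)) , evens-strict j ,
                              evens-chain j (λ i i≤j → below i (m≤n⇒m≤1+n i≤j))

  hasChain : ∀ j → HasChain S (proj₁ (evens-bound j)) j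
  hasChain j = pos (2 * j) , s≤s (proj₂ (evens-bound j) j ≤-refl) ,
               evens-chain j (proj₂ (evens-bound j))

  -- 2 is the least element strictly above 0 in P_0, and 2 < 4.
  signal : ∀ {t} → proj₁ (evens-bound 2) ≤ t → P₀-Signal S t
  signal {t} N≤t =
    pos 0 , s≤s (below 0 z≤n) , pos 2 , s≤s (below 1 (s≤s z≤n)) , pos 4 , s≤s (below 2 ≤-refl) ,
                   (evens-strict 0 , least) , evens-strict 1
    where
    below : ∀ i → i ≤ 2 → pos (2 * i) ≤ t
    below i i≤2 = ≤-trans (proj₂ (evens-bound 2) i i≤2) N≤t
    least : ∀ {z} → z < suc t → Strict S (pos 0) z → z ≡ pos 2 ⊎ Strict S (pos 2) z
    least _ 0≺z with strict-inv 0≺z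
    ... | _ , γ , _ , refl with γ ≟ 2 | proj₂ (Equivalence.to strict-pos⇔ 0≺z)
    ...   | yes refl | _   = inj₁ refl
    ...   | no γ≢2   | 0≢γ =
      inj₂ (Equivalence.from strict-pos⇔ (P₀-complete (inj₂ (1 , refl , one≤ γ 0≢γ)) , γ≢2 ∘ sym))
      where
      one≤ : ∀ γ → 0 ≢ γ → 1 ≤ ⌈ γ /2⌉
      one≤ zero    0≢0 = contradiction refl 0≢0
      one≤ (suc _) _   = s≤s z≤n

module Presentationₛ {S : Str} {K : ℕ} (iso : IsoP S (suc K)) where
  open Presentation iso

  strict-label : ∀ {α β} → Strict S (pos α) (pos β) → ∃ λ i → proj₁ α ≡ 2 * i × i < ⌈ proj₁ β /2⌉
  strict-label {α} {β} α≺β with Equivalence.to strict-pos⇔ α≺β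
  ... | o , α≢β = ⊑-strict (Equivalence.to (POrdₛ⇔ α β) o) (α≢β ∘ label-≡)

  chain-height : ∀ {t j x} → ChainTo S t (suc j) x → ∃ λ β → x ≡ pos β × suc j ≤ ⌈ proj₁ β /2⌉
  chain-height {j = zero} (_ , _ , y≺x , _) with strict-inv y≺x
  ... | α , β , refl , refl = β , refl , ≤-trans (s≤s z≤n) (proj₂ (proj₂ (strict-label y≺x)))
  chain-height {j = suc j} (_ , _ , y≺x , ch) with strict-inv y≺x | chain-height ch
  ... | α , β , refl , refl | α′ , e , j< with pos-injective e
  ...   | refl with strict-label y≺x
  ...     | i , α≡2i , i< = β , refl ,
    ≤-trans (s≤s (subst (suc j ≤_) (⌊1+2*n/2⌋≡n i) (subst (λ a → suc j ≤ ⌈ a /2⌉) α≡2i j<))) i<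

  hasChain-length≤ : ∀ {t j} → HasChain S t j → j ≤ suc (suc K)
  hasChain-length≤ {j = zero}  _            = z≤n
  hasChain-length≤ {j = suc j} (_ , _ , ch) with chain-height ch
  ... | (b , b≤) , _ , j< = ≤-trans j< (⌈n/2⌉≤-bound b≤)

  bound : ∃ λ N → ∀ α → pos α ≤ N
  bound = ≤-bounded _ pos

  N : ℕ
  N = proj₁ bound

  pos< : ∀ {t} → N ≤ t → ∀ α → pos α < suc t
  pos< N≤t α = s≤s (≤-trans (proj₂ bound α) N≤t)

  evenPoint : ∀ {i} → i ≤ suc K → PCar (suc K)
  evenPoint {i} i≤ = 2 * i , ≤-trans (*-monoʳ-≤ 2 i≤) (m≤m+n _ 1)

  evens-chain : ∀ {t} → N ≤ t → ∀ j (j≤ : j ≤ suc K) → ChainTo S t j (pos (evenPoint j≤))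
  evens-chain N≤t zero    _  = tt
  evens-chain N≤t (suc j) j≤ =
    pos (evenPoint (<⇒≤ j≤)) , pos< N≤t _ ,
    Equivalence.from strict-pos⇔ (chainK′ {suc K} j j≤ ◅ ε , 1+n≢n ∘ sym ∘ *2-injective ∘ cong proj₁) ,
    evens-chain N≤t j (<⇒≤ j≤)

  -- 0 < 2 < ⋯ < 2(K+1) < 2(K+1)+1
  longest-chain : ∀ {t} → N ≤ t → HasChain S t (suc (suc K))
  longest-chain N≤t = pos top , pos< N≤t top ,
    pos (evenPoint ≤-refl) , pos< N≤t _ ,
    Equivalence.from strict-pos⇔ (upK′ (suc K) ≤-refl ◅ ε , 1+n≢n ∘ sym ∘ cong proj₁) ,
    evens-chain N≤t (suc K) ≤-refl
    where
    top : PCar (suc K)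
    top = suc (2 * suc K) , ≤-reflexive (+-comm 1 (2 * suc K))

  -- If c is the least element strictly above b = 2i, then c = 2j with i < j, and 2i+1 is a
  -- further element above b that is neither c nor above c.
  no-signal : ∀ {t} → N ≤ t → ¬ P₀-Signal S t
  no-signal N≤t (b , _ , c , _ , d , _ , (b≺c , least) , c≺d) with strict-inv b≺c | strict-inv c≺d
  ... | β , γ , refl , refl | γ′ , δ , e , refl with pos-injective e
  ...   | refl with strict-label b≺c | strict-label c≺d
  ...     | i , β≡2i , i<⌈γ⌉ | j , γ≡2j , j<⌈δ⌉ = neither (least (pos< N≤t ζ) b≺ζ)
    where
    i<j : i < j
    i<j = subst (i <_) (⌊1+2*n/2⌋≡n j) (subst (λ g → i < ⌈ g /2⌉) γ≡2j i<⌈γ⌉)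
    i≤K+1 : i ≤ suc K
    i≤K+1 = ≤-trans (<⇒≤ i<j) (m<1+n⇒m≤n (<-≤-trans j<⌈δ⌉ (⌈n/2⌉≤-bound (proj₂ δ))))
    ζ : PCar (suc K)
    ζ = suc (2 * i) , subst (_≤ 2 * suc K + 1) (+-comm (2 * i) 1) (+-monoˡ-≤ 1 (*-monoʳ-≤ 2 i≤K+1))
    b≺ζ : Strict S (pos β) (pos ζ)
    b≺ζ = Equivalence.from strict-pos⇔
      ( subst (λ a → Star (GenK (suc K)) a (suc (2 * i))) (sym β≡2i) (upK′ i i≤K+1 ◅ ε)
      , λ β≡ζ → even≢odd i i (trans (sym β≡2i) (cong proj₁ β≡ζ)))
    neither : pos ζ ≡ pos γ ⊎ Strict S (pos γ) (pos ζ) → ⊥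
    neither (inj₁ ζ≡γ) = even≢odd j i (sym (trans (cong proj₁ (pos-injective ζ≡γ)) γ≡2j))
    neither (inj₂ c≺ζ) with strict-label c≺ζ
    ... | j′ , γ≡2j′ , j′<1+i = <⇒≱ i<j
      (subst (_≤ i) (*2-injective (trans (sym γ≡2j′) γ≡2j))
             (m<1+n⇒m≤n (subst (j′ <_) (cong suc (⌊2*n/2⌋≡n i)) j′<1+i)))

-- The reduction for E_0

longestChain : Str → ℕ → ℕ → ℕ
longestChain S t zero    = 0
longestChain S t (suc B) = if does (hasChain? S t (suc B)) then suc B else longestChain S t B

longestChain-≡ : ∀ {S t J} B → J ≤ B → HasChain S t J → (∀ j → J < j → ¬ HasChain S t j) →
                 longestChain S t B ≡ J
longestChain-≡ zero z≤n _ _ = refl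
longestChain-≡ {S} {t} (suc B) J≤ has longer with m≤n⇒m<n∨m≡n J≤
... | inj₂ refl rewrite dec-true  (hasChain? S t (suc B)) has            = refl
... | inj₁ J<   rewrite dec-false (hasChain? S t (suc B)) (longer _ J<) = longestChain-≡ B (m<1+n⇒m≤n J<) has longer

longestChain-agree : ∀ {t S S'} → Agree t S S' → ∀ B → longestChain S t B ≡ longestChain S' t B
longestChain-agree agree zero    = refl
longestChain-agree agree (suc B) =
  cong₂ (if_then suc B else_) (hasChain-≡ agree (suc B)) (longestChain-agree agree B)

Γ₀ : Str → Baire
Γ₀ S n = if does (P₀-signal? S n) then 0 else longestChain S n n ∸ 1

Γ₀-agree : ∀ {n S S'} → Agree n S S' → Γ₀ S n ≡ Γ₀ S' n
Γ₀-agree {n} agree = cong₂ (if_then 0 else_) (P₀-signal-≡ agree) (cong (_∸ 1) (longestChain-agree agree n))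

Γ₀-converges : ∀ {S} k → IsoP S k → ∃ λ N → ∀ n → N ≤ n → Γ₀ S n ≡ k
Γ₀-converges {S} zero iso = proj₁ (evens-bound 2) , λ n N≤n →
  cong (if_then 0 else longestChain S n n ∸ 1) (dec-true (P₀-signal? S n) (signal N≤n))
  where open Presentation₀ iso
Γ₀-converges {S} (suc K) iso = N ⊔ suc (suc K) , converges
  where
  open Presentationₛ iso
  converges : ∀ n → N ⊔ suc (suc K) ≤ n → Γ₀ S n ≡ suc K
  converges n ≤n = begin
    Γ₀ S n                ≡⟨ cong (if_then 0 else longestChain S n n ∸ 1)
                                  (dec-false (P₀-signal? S n) (no-signal N≤n)) ⟩
    longestChain S n n ∸ 1 ≡⟨ cong (_∸ 1) (longestChain-≡ n (m⊔n≤o⇒n≤o _ _ ≤n) (longest-chain N≤n)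
                                 (λ j K+2<j has → <⇒≱ K+2<j (hasChain-length≤ has))) ⟩
    suc K                 ∎
    where
    open ≡-Reasoning
    N≤n = m⊔n≤o⇒m≤o _ _ ≤n

IsoP-unique : ∀ {S k k′} → IsoP S k → IsoP S k′ → k ≡ k′
IsoP-unique iso iso′ with Γ₀-converges _ iso | Γ₀-converges _ iso′
... | N , lim | N′ , lim′ = trans (sym (lim _ (m≤m⊔n N N′))) (lim′ _ (m≤n⊔m N N′))

StrIso⇔≡ : ∀ {S S' k k′} → IsoP S k → IsoP S' k′ → StrIso S S' ⇔ k ≡ k′
StrIso⇔≡ iso iso′ = mk⇔ (λ S≅S' → IsoP-unique (IsoP-respects-StrIso iso S≅S') iso′)
                        (λ { refl → IsoP⇒StrIso iso iso′ })

E0⇔limits-≡ : ∀ {p q : Baire} {N N′ a b} → (∀ n → N ≤ n → p n ≡ a) → (∀ n → N′ ≤ n → q n ≡ b) →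
              E0 p q ⇔ a ≡ b
E0⇔limits-≡ {N = N} {N′} lim lim′ = mk⇔
  (λ (m , agree) → let n = m ⊔ (N ⊔ N′) in
     trans (sym (lim n (≤-trans (m≤m⊔n N N′) (m≤n⊔m m _))))
           (trans (agree n (m≤m⊔n m _)) (lim′ n (≤-trans (m≤n⊔m N N′) (m≤n⊔m m _)))))
  (λ { refl → N ⊔ N′ , λ n ≤n →
         trans (lim n (m⊔n≤o⇒m≤o _ _ ≤n)) (sym (lim′ n (m⊔n≤o⇒n≤o _ _ ≤n))) })

E0-learnable : ELearnable E0
E0-learnable = (λ S _ → Γ₀ S)
             , (λ S _ n → n , λ S' _ agree → sym (Γ₀-agree agree))
             , λ S (k , iso) S' (k′ , iso′) →
                 let (N , lim) = Γ₀-converges k iso; (N′ , lim′) = Γ₀-converges k′ iso′ in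
                 ⇔-sym (E0⇔limits-≡ lim lim′) ⇔-∘ StrIso⇔≡ iso iso′

-- The reduction for E_range

diagonal-next : ℕ × ℕ → ℕ × ℕ
diagonal-next (j , zero)  = 0 , suc j
diagonal-next (j , suc t) = suc j , t

unpair : ℕ → ℕ × ℕ
unpair zero    = 0 , 0
unpair (suc n) = diagonal-next (unpair n)

unpair-surjective : ∀ j t → ∃ λ n → unpair n ≡ (j , t)
unpair-surjective j t = reach (j + t) j t ≤-refl
  where
  reach : ∀ s j t → j + t ≤ s → ∃ λ n → unpair n ≡ (j , t)
  reach s       zero    zero    _ = 0 , refl
  reach zero    zero    (suc t) ()
  reach (suc s) zero    (suc t) (s≤s ≤s) with reach s t 0 (subst (_≤ s) (sym (+-identityʳ t)) ≤s)
  ... | n , e = suc n , cong diagonal-next e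
  reach s       (suc j) t       ≤s with reach s j (suc t) (subst (_≤ s) (sym (+-suc j t)) ≤s)
  ... | n , e = suc n , cong diagonal-next e

report : Str → ℕ × ℕ → ℕ
report S (j , t) = if does (hasChain? S t j) then j else 0

Γᵣ : Str → Baire
Γᵣ S n = report S (unpair n)

Γᵣ-agree : ∀ {S S'} n → Agree (proj₂ (unpair n)) S S' → Γᵣ S n ≡ Γᵣ S' n
Γᵣ-agree n agree = cong (if_then proj₁ (unpair n) else 0) (hasChain-≡ agree (proj₁ (unpair n)))

ChainLengths : ℕ → ℕ → Set
ChainLengths zero    j = ⊤
ChainLengths (suc K) j = j ≤ suc (suc K)

ChainLengths-injective : ∀ {k k′} → (∀ j → ChainLengths k j → ChainLengths k′ j) →
                         (∀ j → ChainLengths k′ j → ChainLengths k j) → k ≡ k′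
ChainLengths-injective {zero}  {zero}   _  _  = refl
ChainLengths-injective {zero}  {suc K′} ⊆′ _  = contradiction (⊆′ _ tt) 1+n≰n
ChainLengths-injective {suc K} {zero}   _  ⊇′ = contradiction (⊇′ _ tt) 1+n≰n
ChainLengths-injective {suc K} {suc K′} ⊆′ ⊇′ =
  cong suc (≤-antisym (≤-pred (≤-pred (⊆′ _ ≤-refl))) (≤-pred (≤-pred (⊇′ _ ≤-refl))))

Γᵣ-sound : ∀ {S k} → IsoP S k → ∀ n → ChainLengths k (Γᵣ S n)
Γᵣ-sound {k = zero}      _   n = tt
Γᵣ-sound {S} {k = suc K} iso n with unpair n
... | j , t with hasChain? S t j
...   | yes has = Presentationₛ.hasChain-length≤ iso has
...   | no  _   = z≤n

Γᵣ-hits : ∀ {S t j} → HasChain S t j → ∃ λ n → Γᵣ S n ≡ j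
Γᵣ-hits {S} {t} {j} has with unpair-surjective j t
... | n , e = n , trans (cong (report S) e) (cong (if_then j else 0) (dec-true (hasChain? S t j) has))

Γᵣ-complete : ∀ {S k} → IsoP S k → ∀ j → ChainLengths k j → ∃ λ n → Γᵣ S n ≡ j
Γᵣ-complete {k = zero}  iso j _  = Γᵣ-hits (Presentation₀.hasChain iso j)
Γᵣ-complete {k = suc K} iso j j≤ = Γᵣ-hits (hasChain-downward j≤ (Presentationₛ.longest-chain iso ≤-refl))

Erange⇔≡ : ∀ {S S' k k′} → IsoP S k → IsoP S' k′ → Erange (Γᵣ S) (Γᵣ S') ⇔ k ≡ k′
Erange⇔≡ {S} {S'} iso iso′ = mk⇔
  (λ (⊆′ , ⊇′) → ChainLengths-injective (transfer iso iso′ ⊆′) (transfer iso′ iso ⊇′))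
  (λ { refl → (λ m → let (n , e) = Γᵣ-complete iso′ _ (Γᵣ-sound iso m) in n , sym e)
            , (λ m → let (n , e) = Γᵣ-complete iso _ (Γᵣ-sound iso′ m) in n , sym e) })
  where
  transfer : ∀ {S S' k k′} → IsoP S k → IsoP S' k′ → (∀ m → ∃ λ n → Γᵣ S m ≡ Γᵣ S' n) →
             ∀ j → ChainLengths k j → ChainLengths k′ j
  transfer {k′ = k′} iso iso′ ⊆′ j j∈ with Γᵣ-complete iso j j∈
  ... | m , refl with ⊆′ m
  ...   | n , e = subst (ChainLengths k′) (sym e) (Γᵣ-sound iso′ n)

Erange-learnable : ELearnable Erange
Erange-learnable = (λ S _ → Γᵣ S)
                 , (λ S _ n → proj₂ (unpair n) , λ S' _ agree → Γᵣ-agree n (Agree-sym agree))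
                 , λ S (k , iso) S' (k′ , iso′) → ⇔-sym (Erange⇔≡ iso iso′) ⇔-∘ StrIso⇔≡ iso iso′

Matched : ∀ {k k′} → ℕ ↔ PTCar k → ℕ ↔ PTCar k′ → (PCar k → PCar k′ → Set) → ℕ → Set
Matched f g R x =
  (∃ λ i → ∃ λ i′ → to f x ≡ inj₂ i × to g x ≡ inj₂ i′) ⊎
  (∃ λ α → ∃ λ β → to f x ≡ inj₁ α × to g x ≡ inj₁ β × R α β)

matched-PTOrd : ∀ {k k′} (f : ℕ ↔ PTCar k) (g : ℕ ↔ PTCar k′) R →
  (∀ α α′ β β′ → R α β → R α′ β′ → POrd k α α′ ⇔ POrd k′ β β′) →
  ∀ {x y} → Matched f g R x → Matched f g R y →
  PTOrd k (to f x) (to f y) ⇔ PTOrd k′ (to g x) (to g y)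
matched-PTOrd f g R R-order (inj₁ (i , i′ , fx , gx)) (inj₁ (j , j′ , fy , gy))
  rewrite fx | gx | fy | gy = mk⇔ (≡⇒≡ f g fx fy gx gy) (≡⇒≡ g f gx gy fx fy)
  where
  ≡⇒≡ : ∀ {k k′} (f : ℕ ↔ PTCar k) (g : ℕ ↔ PTCar k′) {x y i j i′ j′} →
        to f x ≡ inj₂ i → to f y ≡ inj₂ j → to g x ≡ inj₂ i′ → to g y ≡ inj₂ j′ → i ≡ j → i′ ≡ j′
  ≡⇒≡ f g {x} {y} fx fy gx gy refl = inj₂-injective (trans (sym gx) (trans (cong (to g) x≡y) gy))
    where
    x≡y : x ≡ y
    x≡y = trans (sym (strictlyInverseʳ f x))
                (trans (cong (from f) (trans fx (sym fy))) (strictlyInverseʳ f y))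
matched-PTOrd f g R R-order (inj₂ (_ , _ , fx , gx , r)) (inj₂ (_ , _ , fy , gy , r′))
  rewrite fx | gx | fy | gy = R-order _ _ _ _ r r′
matched-PTOrd f g R R-order (inj₁ (_ , _ , fx , gx)) (inj₂ (_ , _ , fy , gy , _))
  rewrite fx | gx | fy | gy = mk⇔ (λ ()) (λ ())
matched-PTOrd f g R R-order (inj₂ (_ , _ , fx , gx , _)) (inj₁ (_ , _ , fy , gy))
  rewrite fx | gx | fy | gy = mk⇔ (λ ()) (λ ())

agree-if-matched : ∀ {n S S' k k′} (iso : IsoP S k) (iso′ : IsoP S' k′) R →
  (∀ α α′ β β′ → R α β → R α′ β′ → POrd k α α′ ⇔ POrd k′ β β′) →
  (∀ x → x ≤ n → Matched (proj₁ iso) (proj₁ iso′) R x) → Agree n S S'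
agree-if-matched (f , f-iso) (g , g-iso) R R-order matched x y x≤ y≤ = ≡true-ext
  (⇔-sym (g-iso x y) ⇔-∘ (matched-PTOrd f g R R-order (matched x x≤) (matched y y≤) ⇔-∘ f-iso x y))

relabel : (ℕ → ℕ) → (ℕ → ℕ) → ℕ → ℕ
relabel g h = merge ∘ Sum.map g h ∘ split

relabel-injective : ∀ {g h} → Injective _≡_ _≡_ g → Injective _≡_ _≡_ h → Injective _≡_ _≡_ (relabel g h)
relabel-injective {g} {h} g-inj h-inj {s} {s′} e =
  trans (sym (merge-split s)) (trans (cong merge (unmap (split s) (split s′)
    (trans (sym (split-merge _)) (trans (cong split e) (split-merge _))))) (merge-split s′))
  where
  unmap : ∀ a c → Sum.map g h a ≡ Sum.map g h c → a ≡ c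
  unmap (inj₁ _) (inj₁ _) e = cong inj₁ (g-inj (inj₁-injective e))
  unmap (inj₂ _) (inj₂ _) e = cong inj₂ (h-inj (inj₂-injective e))

relabel-even : ∀ g h i → relabel g h (2 * i) ≡ 2 * g i
relabel-even g h i = cong (merge ∘ Sum.map g h) (split-even i)

relabel-odd : ∀ g h i → relabel g h (suc (2 * i)) ≡ suc (2 * h i)
relabel-odd g h i = cong (merge ∘ Sum.map g h) (split-odd i)

-- φ embeds P_0 into P_k (2j−1 ↦ 2j+1), and ψ embeds P_k into P_0 (2i ↦ 2i+2).

φ : ℕ → ℕ
φ = relabel id suc

ψ : ℕ → ℕ
ψ = relabel suc id

φ-injective : Injective _≡_ _≡_ φ
φ-injective = relabel-injective id suc-injective

ψ-injective : Injective _≡_ _≡_ ψ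
ψ-injective = relabel-injective suc-injective id

ψ∘φ≡2+ : ∀ s → ψ (φ s) ≡ suc (suc s)
ψ∘φ≡2+ s with evenOdd s
... | even i rewrite relabel-even id suc i | relabel-even suc id i = *-suc 2 i
... | odd i  rewrite relabel-odd id suc i  | relabel-odd suc id (suc i) = cong suc (*-suc 2 i)

⌊φ/2⌋≡⌈/2⌉ : ∀ s → ⌊ φ s /2⌋ ≡ ⌈ s /2⌉
⌊φ/2⌋≡⌈/2⌉ s with evenOdd s
... | even i rewrite relabel-even id suc i = trans (⌊2*n/2⌋≡n i) (sym (⌊1+2*n/2⌋≡n i))
... | odd i  rewrite relabel-odd id suc i  = trans (⌊1+2*n/2⌋≡n (suc i)) (cong suc (sym (⌊2*n/2⌋≡n i)))

⌈ψ/2⌉≡1+⌊/2⌋ : ∀ b → ⌈ ψ b /2⌉ ≡ suc ⌊ b /2⌋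
⌈ψ/2⌉≡1+⌊/2⌋ b with evenOdd b
... | even i rewrite relabel-even suc id i = trans (⌊1+2*n/2⌋≡n (suc i)) (cong suc (sym (⌊2*n/2⌋≡n i)))
... | odd i  rewrite relabel-odd suc id i  = cong suc (trans (⌊2*n/2⌋≡n i) (sym (⌊1+2*n/2⌋≡n i)))

φ-⊑ : ∀ s s′ → s ⊑[ ⌈_/2⌉ ] s′ ⇔ φ s ⊑[ ⌊_/2⌋ ] φ s′
φ-⊑ s s′ = mk⇔ forth back
  where
  forth : s ⊑[ ⌈_/2⌉ ] s′ → φ s ⊑[ ⌊_/2⌋ ] φ s′
  forth (inj₁ s≡s′)            = inj₁ (cong φ s≡s′)
  forth (inj₂ (i , refl , i≤)) =
    inj₂ (i , relabel-even id suc i , subst (i ≤_) (sym (⌊φ/2⌋≡⌈/2⌉ s′)) i≤)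
  back : φ s ⊑[ ⌊_/2⌋ ] φ s′ → s ⊑[ ⌈_/2⌉ ] s′
  back (inj₁ e)            = inj₁ (φ-injective e)
  back (inj₂ (i , e , i≤)) = inj₂ (i , φ-injective (trans e (sym (relabel-even id suc i))) ,
                                   subst (i ≤_) (⌊φ/2⌋≡⌈/2⌉ s′) i≤)

ψ-⊑ : ∀ b b′ → b ⊑[ ⌊_/2⌋ ] b′ ⇔ ψ b ⊑[ ⌈_/2⌉ ] ψ b′
ψ-⊑ b b′ = mk⇔ forth (back (evenOdd b))
  where
  forth : b ⊑[ ⌊_/2⌋ ] b′ → ψ b ⊑[ ⌈_/2⌉ ] ψ b′
  forth (inj₁ b≡b′)            = inj₁ (cong ψ b≡b′)
  forth (inj₂ (i , refl , i≤)) =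
    inj₂ (suc i , relabel-even suc id i , subst (suc i ≤_) (sym (⌈ψ/2⌉≡1+⌊/2⌋ b′)) (s≤s i≤))
  back : ∀ {b} → EvenOdd b → ψ b ⊑[ ⌈_/2⌉ ] ψ b′ → b ⊑[ ⌊_/2⌋ ] b′
  back _ (inj₁ e) = inj₁ (ψ-injective e)
  back (even i) (inj₂ (i′ , e , i′≤)) with *2-injective {suc i} {i′} (trans (sym (relabel-even suc id i)) e)
  ... | refl = inj₂ (i , refl , ≤-pred (subst (suc i ≤_) (⌈ψ/2⌉≡1+⌊/2⌋ b′) i′≤))
  back (odd i) (inj₂ (i′ , e , _)) = contradiction (trans (sym e) (relabel-odd suc id i)) (even≢odd i′ i)

φ-order : ∀ {K} s s′ (β β′ : PCar (suc K)) → proj₁ β ≡ φ s → proj₁ β′ ≡ φ s′ →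
          POrd 0 s s′ ⇔ POrd (suc K) β β′
φ-order s s′ β β′ refl refl = ⇔-sym (POrdₛ⇔ β β′) ⇔-∘ (φ-⊑ s s′ ⇔-∘ POrd₀⇔)

ψ-order : ∀ {K} (β β′ : PCar (suc K)) e e′ → e ≡ ψ (proj₁ β) → e′ ≡ ψ (proj₁ β′) →
          POrd (suc K) β β′ ⇔ POrd 0 e e′
ψ-order β β′ _ _ refl refl = ⇔-sym POrd₀⇔ ⇔-∘ (ψ-⊑ (proj₁ β) (proj₁ β′) ⇔-∘ POrdₛ⇔ β β′)

cut : {A : Set} (n M : ℕ) → (n < M → A) → (ℕ → A) → A
cut n M below above with n <? M
... | yes n<M = below n<M
... | no  _   = above (n ∸ M)

cut-< : ∀ {A : Set} {n M} {below : n < M → A} {above} (n<M : n < M) → cut n M below above ≡ below n<M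
cut-< {n = n} {M} {below} n<M with n <? M
... | yes n<M′ = cong below (<-irrelevant n<M′ n<M)
... | no  n≮M  = contradiction n<M n≮M

cut-+ : ∀ {A : Set} {M} r {below : M + r < M → A} {above : ℕ → A} → cut (M + r) M below above ≡ above r
cut-+ {M = M} r {above = above} with M + r <? M
... | yes M+r<M = contradiction (m≤m+n M r) (<⇒≱ M+r<M)
... | no  _     = cong above (m+n∸m≡n M r)

cut-self : ∀ {A : Set} {M} {below : M < M → A} {above : ℕ → A} → cut M M below above ≡ above 0
cut-self {M = M} {above = above} with M <? M
... | yes M<M = contradiction M<M (<-irrefl refl)
... | no  _   = cong above (n∸n≡0 M)

data Cut (M : ℕ) : ℕ → Set where
  below : ∀ {n} → n < M → Cut M n
  above : ∀ r → Cut M (M + r)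

cut-view : ∀ M n → Cut M n
cut-view M n with n <? M
... | yes n<M = below n<M
... | no  n≮M = subst (Cut M) (m+[n∸m]≡n (≮⇒≥ n≮M)) (above (n ∸ M))

-- B presents P̃_(K+1) and agrees with the presentation ℕ↔ℕ⊎ℕ of P̃_0 up to K; C presents P̃_0
-- and agrees with B up to T.

module LookAlikes (K : ℕ) where

  M : ℕ
  M = 2 * suc K + 1

  K<M : K < M
  K<M = <-≤-trans (n<1+n K) (≤-trans (m≤n*m (suc K) 2) (m≤m+n _ 1))

  φ-≤M : ∀ {s} → s < M → φ s ≤ M
  φ-≤M {s} s<M with evenOdd s
  ... | even i rewrite relabel-even id suc i = <⇒≤ s<M
  ... | odd i  rewrite relabel-odd id suc i  =
    subst (_≤ M) (+-comm (2 * suc i) 1) (+-monoˡ-≤ 1 (*-monoʳ-≤ 2 i<K+1))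
    where i<K+1 = subst (_≤ suc K) (cong suc (⌊2*n/2⌋≡n i)) (⌊n/2⌋≤-bound {K = suc K} s<M)

  -- even positions 2s with s < M carry φ s, 2M carries 1; all other positions are isolated
  labelB : ℕ → PTCar (suc K)
  labelB s = cut s M (λ s<M → inj₁ (φ s , φ-≤M s<M))
                     λ { zero → inj₁ (1 , s≤s z≤n) ; (suc r) → inj₂ (2 * r) }

  toB : ℕ → PTCar (suc K)
  toB = interleave labelB (λ z → inj₂ (suc (2 * z)))

  unφ : ℕ → ℕ
  unφ = interleave (2 *_) λ { zero → M ; (suc i) → suc (2 * i) }

  fromB : PTCar (suc K) → ℕ
  fromB (inj₁ (b , _)) = 2 * unφ b
  fromB (inj₂ j)       = interleave (λ r → 2 * (M + suc r)) (λ z → suc (2 * z)) j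

  unφ-φ : ∀ s → unφ (φ s) ≡ s
  unφ-φ s with evenOdd s
  ... | even i = trans (cong unφ (relabel-even id suc i)) (interleave-even i)
  ... | odd i  = trans (cong unφ (relabel-odd id suc i)) (interleave-odd (suc i))

  toB-fromB : ∀ a → toB (fromB a) ≡ a
  toB-fromB (inj₂ j) with evenOdd j
  ... | even r = trans (cong toB (interleave-even r)) (trans (interleave-even (M + suc r)) (cut-+ {M = M} (suc r)))
  ... | odd z  = trans (cong toB (interleave-odd z)) (interleave-odd z)
  toB-fromB (inj₁ (b , b≤M)) with evenOdd b
  ... | even i = trans (cong toB (cong (2 *_) (interleave-even i)))
                  (trans (interleave-even (2 * i))
                    (trans (cut-< (≤∧≢⇒< b≤M λ e → even≢odd i (suc K) (trans e (+-comm _ 1))))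
                      (cong inj₁ (label-≡ (relabel-even id suc i)))))
  ... | odd zero    = trans (interleave-even M) (trans (cut-self {M = M}) (cong inj₁ (label-≡ refl)))
  ... | odd (suc i) = trans (cong toB (cong (2 *_) (interleave-odd (suc i))))
                       (trans (interleave-even (suc (2 * i)))
                         (trans (cut-< (<-≤-trans 2i+1<b b≤M))
                           (cong inj₁ (label-≡ (relabel-odd id suc i)))))
    where
    2i+1<b : suc (2 * i) < suc (2 * suc i)
    2i+1<b = s≤s (subst (suc (2 * i) ≤_) (sym (*-suc 2 i)) (n≤1+n _))

  fromB-toB : ∀ n → fromB (toB n) ≡ n
  fromB-toB n with evenOdd n
  ... | odd z = trans (cong fromB (interleave-odd z)) (interleave-odd z)
  ... | even s with cut-view M s
  ...   | below s<M     = trans (cong fromB (trans (interleave-even s) (cut-< s<M))) (cong (2 *_) (unφ-φ s))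
  ...   | above zero    = trans (cong fromB (trans (interleave-even (M + 0)) (cut-+ {M = M} 0)))
                                (cong (2 *_) (sym (+-identityʳ M)))
  ...   | above (suc r) = trans (cong fromB (trans (interleave-even (M + suc r)) (cut-+ {M = M} (suc r))))
                                (interleave-even r)

  fB : ℕ ↔ PTCar (suc K)
  fB = mk↔ₛ′ toB fromB toB-fromB fromB-toB

  matched-AB : ∀ x → x ≤ K → Matched ℕ↔ℕ⊎ℕ fB (λ s β → proj₁ β ≡ φ s) x
  matched-AB x x≤K with evenOdd x
  ... | even s = inj₂ (_ , _ , split-even s , trans (interleave-even s) (cut-< s<M) , refl)
    where s<M = ≤-<-trans (m≤n*m s 2) (≤-<-trans x≤K K<M)
  ... | odd z  = inj₁ (_ , _ , split-odd z , interleave-odd z)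

  module _ (T : ℕ) where

    -- even positions 2s with s < M carry s+2 = ψ (φ s), 2M carries 1 = ψ 1, and 2T+1 carries 0
    labelC : ℕ → PTCar 0
    labelC s = cut s M (λ _ → inj₁ (suc (suc s))) λ { zero → inj₁ 1 ; (suc r) → inj₂ (T + r) }

    oddC : ℕ → PTCar 0
    oddC x = cut x T (λ _ → inj₂ x) λ { zero → inj₁ 0 ; (suc r) → inj₁ (suc (suc (M + r))) }

    toC : ℕ → PTCar 0
    toC = interleave labelC oddC

    fromC : PTCar 0 → ℕ
    fromC (inj₁ zero)          = suc (2 * T)
    fromC (inj₁ (suc zero))    = 2 * M
    fromC (inj₁ (suc (suc s))) = cut s M (λ _ → 2 * s) (λ r → suc (2 * (T + suc r)))
    fromC (inj₂ j)             = cut j T (λ _ → suc (2 * j)) (λ r → 2 * (M + suc r))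

    toC-fromC : ∀ a → toC (fromC a) ≡ a
    toC-fromC (inj₁ zero)          = trans (interleave-odd T) (cut-self {M = T})
    toC-fromC (inj₁ (suc zero))    = trans (interleave-even M) (cut-self {M = M})
    toC-fromC (inj₁ (suc (suc s))) with cut-view M s
    ... | below s<M = trans (cong toC (cut-< s<M)) (trans (interleave-even s) (cut-< s<M))
    ... | above r   = trans (cong toC (cut-+ {M = M} r)) (trans (interleave-odd (T + suc r)) (cut-+ {M = T} (suc r)))
    toC-fromC (inj₂ j) with cut-view T j
    ... | below j<T = trans (cong toC (cut-< j<T)) (trans (interleave-odd j) (cut-< j<T))
    ... | above r   = trans (cong toC (cut-+ {M = T} r)) (trans (interleave-even (M + suc r)) (cut-+ {M = M} (suc r)))

    fromC-toC : ∀ n → fromC (toC n) ≡ n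
    fromC-toC n with evenOdd n
    fromC-toC n | even s with cut-view M s
    ... | below s<M     = trans (cong fromC (trans (interleave-even s) (cut-< s<M))) (cut-< s<M)
    ... | above zero    = trans (cong fromC (trans (interleave-even (M + 0)) (cut-+ {M = M} 0)))
                                (cong (2 *_) (sym (+-identityʳ M)))
    ... | above (suc r) = trans (cong fromC (trans (interleave-even (M + suc r)) (cut-+ {M = M} (suc r))))
                                (cut-+ {M = T} r)
    fromC-toC n | odd x with cut-view T x
    ... | below x<T     = trans (cong fromC (trans (interleave-odd x) (cut-< x<T))) (cut-< x<T)
    ... | above zero    = trans (cong fromC (trans (interleave-odd (T + 0)) (cut-+ {M = T} 0)))
                                (cong (suc ∘ (2 *_)) (sym (+-identityʳ T)))
    ... | above (suc r) = trans (cong fromC (trans (interleave-odd (T + suc r)) (cut-+ {M = T} (suc r))))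
                                (cut-+ {M = M} r)

    fC : ℕ ↔ PTCar 0
    fC = mk↔ₛ′ toC fromC toC-fromC fromC-toC

    matched-BC : ∀ x → x ≤ T → Matched fB fC (λ β e → e ≡ ψ (proj₁ β)) x
    matched-BC x x≤T with evenOdd x
    matched-BC x x≤T | odd z  = inj₁ (_ , _ , interleave-odd z , trans (interleave-odd z) (cut-< z<T))
      where z<T = <-≤-trans (s≤s (m≤n*m z 2)) x≤T
    matched-BC x x≤T | even s with cut-view M s
    ... | below s<M     = inj₂ (_ , _ , trans (interleave-even s) (cut-< s<M) ,
                                        trans (interleave-even s) (cut-< s<M) , sym (ψ∘φ≡2+ s))
    ... | above zero    = inj₂ (_ , _ , trans (interleave-even (M + 0)) (cut-+ {M = M} 0) ,
                                        trans (interleave-even (M + 0)) (cut-+ {M = M} 0) , refl)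
    ... | above (suc r) = inj₁ (_ , _ , trans (interleave-even (M + suc r)) (cut-+ {M = M} (suc r)) ,
                                        trans (interleave-even (M + suc r)) (cut-+ {M = M} (suc r)))

Agree-trans : ∀ {t S S' S''} → Agree t S S' → Agree t S' S'' → Agree t S S''
Agree-trans agree agree′ x y x≤ y≤ = trans (agree x y x≤ y≤) (agree′ x y x≤ y≤)

Agree-≤ : ∀ {t t′ S S'} → t′ ≤ t → Agree t S S' → Agree t′ S S'
Agree-≤ t′≤t agree x y x≤ y≤ = agree x y (≤-trans x≤ t′≤t) (≤-trans y≤ t′≤t)

¬NUs-learnable : ¬ NUsLearnable
¬NUs-learnable (L , ex , locked) = 0≢1+n (just-injective (trans (sym C-at-T) C-at-T′))
  where
  open Learner L renaming (M to guess)
  settles : ∀ {S} k (iso : IsoP S k) → Converges (guess S (k , iso)) k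
  settles k iso = Equivalence.from (ex _ (k , iso) k) iso

  isoA = presentation-IsoP 0 ℕ↔ℕ⊎ℕ
  N  = proj₁ (settles 0 isoA)
  open LookAlikes N
  isoB = presentation-IsoP (suc N) fB
  N′ = proj₁ (settles (suc N) isoB)
  T  = N ⊔ N′
  isoC = presentation-IsoP 0 (fC T)

  A≈B : Agree N (presentation 0 ℕ↔ℕ⊎ℕ) (presentation (suc N) fB)
  A≈B = agree-if-matched isoA isoB _ φ-order matched-AB
  B≈C : Agree T (presentation (suc N) fB) (presentation 0 (fC T))
  B≈C = agree-if-matched isoB isoC _ ψ-order (matched-BC T)

  C-at-N : guess _ (0 , isoC) N ≡ just 0
  C-at-N = trans (coherent _ _ (0 , isoC) (0 , isoA) N
                   (Agree-sym (Agree-trans A≈B (Agree-≤ (m≤m⊔n N N′) B≈C))))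
                 (proj₂ (settles 0 isoA) N ≤-refl)
  C-at-T : guess _ (0 , isoC) T ≡ just 0
  C-at-T = locked _ (0 , isoC) 0 isoC N C-at-N T (m≤m⊔n N N′)
  C-at-T′ : guess _ (0 , isoC) T ≡ just (suc N)
  C-at-T′ = trans (coherent _ _ (0 , isoC) (suc N , isoB) T (Agree-sym B≈C))
                  (proj₂ (settles (suc N) isoB) T (m≤n⊔m N N′))

mainTheorem14 : ELearnable E0 × ELearnable Erange × ¬ NUsLearnable
mainTheorem14 = E0-learnable , Erange-learnable , ¬NUs-learnable
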